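{- In the setting below, for every stack configuration $\rho$ and every $v\in V_0$ we have $\Phi(E_v^+\rho)=E_v^-(\Phi(\rho))$ and $t_v^+(\rho)=t_v^-(\Phi(\rho))$.
   Context: $G=(V,E)$ is a finite strongly connected directed graph, $T\subseteq V$ a nonempty set of targets, $V_0=V\setminus T$, $d(v)$ the out-degree. A stack configuration $\rho$ assigns to each $v\in V_0$ a bi-infinite sequence $\rho_v=(a^v_i)_{i\in\mathbb{Z}}$ of arcs leaving $v$, periodic with period $d(v)$, such that $a^v_1,\dots,a^v_{d(v)}$ are the $d(v)$ distinct arcs leaving $v$ (pictured $[\dots,a_0\,|\,a_1,\dots]$). Popping the stack at $v$ replaces $(a_i)$ by $(a_{i+1})_i$; pushing replaces it by $(a_{i-1})_i$. A particle step at $v$: pop the stack at $v$, then the particle moves along the new $a^v_0$. An antiparticle step at $v$: the antiparticle moves along the current $a^v_0$, then the stack at $v$ is pushed. Particles and antiparticles stop on reaching $T$. $E_v^+\rho$ (resp. $E_v^-\rho$) is the stack configuration after adding one particle (resp. antiparticle) at $v$ and letting it step until it reaches $T$, and $t_v^+(\rho)$ (resp. $t_v^-(\rho)$) is the target where it stops. Flipping $\Phi$ replaces every stack $(a_i)$ by $(a'_i)$ with $a'_i=a_{1-i}$. -}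

module Defs where

open import Data.Nat using (ℕ; suc)
open import Data.Fin using (Fin; _≟_)
open import Data.Fin.Subset using (Subset; _∈_; _∉_; Nonempty)
open import Data.Integer using (ℤ; +_; _+_; _-_)
open import Data.List using (List; length; filter; allFin)
open import Data.Product using (Σ; ∃; _×_; _,_)
open import Relation.Binary.PropositionalEquality using (_≡_)
open import Relation.Nullary using (yes; no)

record Graph : Set where
  field
    n   : ℕ
    m   : ℕ
    src : Fin m → Fin n
    tgt : Fin m → Fin n

module _ (G : Graph) where
  open Graph G

  Vertex : Set
  Vertex = Fin n

  Arc : Set
  Arc = Fin m

  data Path : Vertex → Vertex → Set where
    []  : ∀ {v} → Path v v
    _∷_ : ∀ {w} (e : Arc) → Path (tgt e) w → Path (src e) w

  StronglyConnected : Set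
  StronglyConnected = ∀ u w → Path u w

  outdeg : Vertex → ℕ
  outdeg v = length (filter (λ e → src e ≟ v) (allFin m))

  -- a stack configuration: to every vertex a bi-infinite sequence of arcs
  -- (only the stacks at non-target vertices matter)
  Config : Set
  Config = Vertex → ℤ → Arc

  update : Config → Vertex → (ℤ → Arc) → Config
  update ρ v s w with w ≟ v
  ... | yes _ = s
  ... | no  _ = ρ w

  pop : Config → Vertex → Config
  pop ρ v = update ρ v (λ i → ρ v (i + + 1))

  push : Config → Vertex → Config
  push ρ v = update ρ v (λ i → ρ v (i - + 1))

  Φ : Config → Config
  Φ ρ w i = ρ w (+ 1 - i)

  module _ (T : Subset n) where

    ValidConfig : Config → Set
    ValidConfig ρ = ∀ v → v ∉ T →
        (∀ i → src (ρ v i) ≡ v)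
      × (∀ i → ρ v (i + + outdeg v) ≡ ρ v i)
      × (∀ (j k : Fin (outdeg v)) →
           ρ v (+ suc (Data.Fin.toℕ j)) ≡ ρ v (+ suc (Data.Fin.toℕ k)) → j ≡ k)
      × (∀ e → src e ≡ v → ∃ λ (k : Fin (outdeg v)) → ρ v (+ suc (Data.Fin.toℕ k)) ≡ e)

    -- Particle step at v: pop the stack at v, then move along the new a_0
    -- (which is the old a_1).
    data ParticleRun (ρ : Config) (v : Vertex) : Config → Vertex → Set where
      stop : v ∈ T → ParticleRun ρ v ρ v
      step : ∀ {ρ' t} → v ∉ T →
             ParticleRun (pop ρ v) (tgt (pop ρ v v (+ 0))) ρ' t →
             ParticleRun ρ v ρ' t

    data AntiparticleRun (ρ : Config) (v : Vertex) : Config → Vertex → Set where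
      stop : v ∈ T → AntiparticleRun ρ v ρ v
      step : ∀ {ρ' t} → v ∉ T →
             AntiparticleRun (push ρ v) (tgt (ρ v (+ 0))) ρ' t →
             AntiparticleRun ρ v ρ' t

-- Flipping turns a pop into a push: the flipped popped stack (a_{2-i})_i is
-- the push of the flipped stack (a_{1-i})_i, and the arc a particle leaves
-- along after popping, a_1, is the arc a_0' = a_{1-0} an antiparticle leaves
-- along in the flipped configuration. Hence the antiparticle run from Φ ρ
-- follows the particle run from ρ step by step, keeping the configurations
-- flips of each other.
module Submission where

open import Defs
open import Data.Fin using (_≟_)
open import Data.Fin.Subset using (Subset; _∉_; Nonempty)
open import Data.Integer using (ℤ; +_; _+_; _-_)
open import Data.Integer.Tactic.RingSolver using (solve-∀)
open import Data.Product using (Σ; _×_; _,_)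
open import Relation.Binary.PropositionalEquality
open import Relation.Nullary using (yes; no; contradiction)

1-[i-1]≡[1-i]+1 : ∀ (i : ℤ) → + 1 - (i - + 1) ≡ (+ 1 - i) + + 1
1-[i-1]≡[1-i]+1 = solve-∀

module _ (G : Graph) where
  open Graph G

  _≈_ : Config G → Config G → Set
  ρ ≈ σ = ∀ w i → ρ w i ≡ σ w i

  update-self : ∀ ρ v s i → update G ρ v s v i ≡ s i
  update-self ρ v s i with v ≟ v
  ... | yes _   = refl
  ... | no  v≢v = contradiction refl v≢v

  push-cong : ∀ {ρ σ} v → ρ ≈ σ → push G ρ v ≈ push G σ v
  push-cong v ρ≈σ w i with w ≟ v
  ... | yes refl = ρ≈σ w (i - + 1)
  ... | no  _    = ρ≈σ w i

  push-Φ≈Φ-pop : ∀ ρ v → push G (Φ G ρ) v ≈ Φ G (pop G ρ v)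
  push-Φ≈Φ-pop ρ v w i with w ≟ v
  ... | yes refl = cong (ρ w) (1-[i-1]≡[1-i]+1 i)
  ... | no  _    = refl

  pop-top≡Φ-top : ∀ ρ v → pop G ρ v v (+ 0) ≡ Φ G ρ v (+ 0)
  pop-top≡Φ-top ρ v = update-self ρ v _ (+ 0)

  module _ (T : Subset n) where

    particleRun⇒antiparticleRun :
      ∀ {ρ v ρ' t} σ → ParticleRun G T ρ v ρ' t → σ ≈ Φ G ρ →
      Σ (Config G) (λ σ' → AntiparticleRun G T σ v σ' t × σ' ≈ Φ G ρ')
    particleRun⇒antiparticleRun σ (stop v∈T) σ≈Φρ = σ , stop v∈T , σ≈Φρ
    particleRun⇒antiparticleRun {ρ} {v} {t = t} σ (step v∉T run) σ≈Φρ
      with particleRun⇒antiparticleRun (push G σ v) run σ↑≈Φρ↓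
      where
      σ↑≈Φρ↓ : push G σ v ≈ Φ G (pop G ρ v)
      σ↑≈Φρ↓ w i = trans (push-cong v σ≈Φρ w i) (push-Φ≈Φ-pop ρ v w i)
    ... | σ' , antiRun , σ'≈Φρ' =
      σ' , step v∉T (subst (λ u → AntiparticleRun G T (push G σ v) u σ' t) same-arc antiRun) , σ'≈Φρ'
      where
      same-arc : tgt (pop G ρ v v (+ 0)) ≡ tgt (σ v (+ 0))
      same-arc = cong tgt (trans (pop-top≡Φ-top ρ v) (sym (σ≈Φρ v (+ 0))))

-- Strong connectivity, nonemptiness of T, validity of ρ and v ∉ T are
-- deliberately unused: the correspondence holds for every particle run.
lemma4p4 : (G : Graph) → StronglyConnected G →
    (T : Subset (Graph.n G)) → Nonempty T →
    (ρ : Config G) → ValidConfig G T ρ →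
    (v : Vertex G) → v ∉ T →
    (ρ' : Config G) (t : Vertex G) → ParticleRun G T ρ v ρ' t →
    Σ (Config G) (λ σ → AntiparticleRun G T (Φ G ρ) v σ t
    × (∀ w i → σ w i ≡ Φ G ρ' w i))
lemma4p4 G _ T _ ρ _ v _ ρ' t run =
  particleRun⇒antiparticleRun G T (Φ G ρ) run (λ w i → refl)
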